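{- Let $G$ be a simple subcubic graph whose vertex set can be partitioned into two sets $U$ and $V$ such that the induced subgraph $G[V]$ contains at most one edge and every vertex of $U$ has degree at most $2$ in $G$. Then $G$ has a proper $3$-edge-coloring.
   Context: A graph is subcubic if its maximum degree is at most $3$. -}

module Defs where

open import Data.Nat using (ℕ; _≤_)
open import Data.Fin using (Fin)
open import Data.Bool using (Bool; true; false)
open import Data.List using (map; allFin)
open import Data.Nat.ListAction using (sum)
open import Data.Bool using (if_then_else_)
open import Relation.Nullary using (¬_)
open import Relation.Binary.PropositionalEquality using (_≡_)
open import Data.Product using (_×_)
open import Data.Sum using (_⊎_)

record SimpleGraph (n : ℕ) : Set where
  field
    adj   : Fin n → Fin n → Bool
    sym   : ∀ i j → adj i j ≡ adj j i
    irref : ∀ i → adj i i ≡ false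

open SimpleGraph public

Adj : ∀ {n} → SimpleGraph n → Fin n → Fin n → Set
Adj G i j = adj G i j ≡ true

degree : ∀ {n : ℕ} → SimpleGraph n → Fin n → ℕ
degree {n} G i = sum (map (λ j → if adj G i j then 1 else 0) (allFin n))

Subcubic : ∀ {n} → SimpleGraph n → Set
Subcubic G = ∀ i → degree G i ≤ 3

-- A proper 3-edge-colouring: a colour for each (unordered) edge,
-- represented by a function on ordered pairs that is symmetric on edges,
-- such that two distinct edges sharing an endpoint get distinct colours.
record Proper3EdgeColoring {n : ℕ} (G : SimpleGraph n) : Set where
  field
    col     : Fin n → Fin n → Fin 3
    col-sym : ∀ i j → Adj G i j → col i j ≡ col j i
    proper  : ∀ i j k → Adj G i j → Adj G i k → ¬ (j ≡ k) → ¬ (col i j ≡ col i k)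

{-# OPTIONS --safe #-}
module Submission where

-- The edges are coloured greedily in three rounds: the at most one edge of G[V], then the
-- U–V edges, then the U–U edges. A vertex of degree d with an uncoloured edge sees at most
-- d − 1 colours. So a U–U edge always has a colour free at both ends, and at a U–V edge uv
-- the vertex u sees at most one colour c. If v also sees c, some other colour is free at v
-- and hence at u. Otherwise choose β ≠ c not used on G[V] and swap β and c on the Kempe
-- chain starting at v. As long as no U–U edge is coloured, this chain alternates between V
-- and U and enters every U-vertex along a β-edge, so it cannot reach u, which sees only c.
-- After the swap, β is free at both u and v.

open import Defs hiding (sym; irref)
open import Data.Bool using (Bool; true; false; not; _∧_; _∨_; if_then_else_)
import Data.Bool as Bool
open import Data.Bool.Properties using (∧-comm; ∨-zeroʳ; ∨-identityʳ)
open import Data.Empty using (⊥; ⊥-elim)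
open import Data.Fin using (Fin; zero; suc; _≟_)
open import Data.Fin.Patterns using (0F; 1F; 2F)
open import Data.Fin.Permutation.Components using (transpose; transpose-inverse)
open import Data.Fin.Properties using (any?; all?; ¬∀⟶∃¬)
open import Data.Fin.Subset using (Subset; _∈_; _∉_; _⊂_; _⊃_; ∣_∣; ⁅_⁆; _∪_; _-_)
open import Data.Fin.Subset.Induction using (Acc; acc; ⊃-wellFounded)
open import Data.Fin.Subset.Properties
  using (_∈?_; x∈⁅x⁆; x∈⁅y⁆⇒x≡y; x∈p∪q⁺; x∈p∪q⁻; p⊆p∪q; x∈p⇒∣p-x∣<∣p∣; x∈p∧x≢y⇒x∈p-y)
open import Data.List using ([]; _∷_; length; allFin; cartesianProduct)
import Data.List as List
import Data.List.Properties as List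
open import Data.List.Membership.Propositional.Properties using (∈-allFin; ∈-cartesianProduct⁺)
open import Data.List.Relation.Unary.All as All using (All; []; _∷_)
open import Data.List.Relation.Unary.AllPairs using ([]; _∷_)
open import Data.List.Relation.Unary.Unique.Propositional using (Unique)
open import Data.Nat using (ℕ; _≤_; z≤n; s≤s)
open import Data.Nat.ListAction using (sum)
open import Data.Nat.Properties using (≤-trans; <⇒≱)
open import Data.Product using (∃; _×_; _,_; proj₁; proj₂)
open import Data.Sum using (_⊎_; inj₁; inj₂)
import Data.Sum as Sum
import Data.Vec as Vec
open import Data.Vec.Properties using (lookup∘tabulate; lookup⇒[]=)
open import Function using (_∘_; mk⇔)
open import Relation.Nullary using (¬_; ¬?; Dec; yes; no; does; contradiction)
open import Relation.Nullary.Decidable using (_×-dec_; _⊎-dec_; dec-true; dec-false; does-⇔)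
open import Relation.Binary.PropositionalEquality
  using (_≡_; _≢_; refl; sym; trans; cong; cong₂; subst)

private
  variable
    n : ℕ

neighbours : SimpleGraph n → Fin n → Subset n
neighbours G i = Vec.tabulate (adj G i)

∈-neighbours : ∀ {G : SimpleGraph n} {i j} → Adj G i j → j ∈ neighbours G i
∈-neighbours {G = G} {i} {j} ij = lookup⇒[]= j _ (trans (lookup∘tabulate (adj G i) j) ij)

sum-indicator≡∣tabulate∣ : (f : Fin n → Bool) →
  sum (List.tabulate (λ j → if f j then 1 else 0)) ≡ ∣ Vec.tabulate f ∣
sum-indicator≡∣tabulate∣ {ℕ.zero}  f = refl
sum-indicator≡∣tabulate∣ {ℕ.suc n} f with f zero
... | true  = cong ℕ.suc (sum-indicator≡∣tabulate∣ (f ∘ suc))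
... | false = sum-indicator≡∣tabulate∣ (f ∘ suc)

degree≡∣neighbours∣ : (G : SimpleGraph n) (i : Fin n) → degree G i ≡ ∣ neighbours G i ∣
degree≡∣neighbours∣ {n} G i =
  trans (cong sum (List.map-tabulate {n = n} (λ j → j) (λ j → if adj G i j then 1 else 0)))
        (sum-indicator≡∣tabulate∣ (adj G i))

unique⊆⇒length≤∣p∣ : ∀ {p : Subset n} {xs} → Unique xs → All (_∈ p) xs → length xs ≤ ∣ p ∣
unique⊆⇒length≤∣p∣ [] [] = z≤n
unique⊆⇒length≤∣p∣ {p = p} {x ∷ xs} (x∉xs ∷ xs!) (x∈p ∷ xs⊆p) =
  ≤-trans (s≤s (unique⊆⇒length≤∣p∣ xs! xs⊆p-x)) (x∈p⇒∣p-x∣<∣p∣ x∈p)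
  where
  xs⊆p-x : All (_∈ p - x) xs
  xs⊆p-x = All.zipWith (λ (x≢y , y∈p) → x∈p∧x≢y⇒x∈p-y {p = p} y∈p (x≢y ∘ sym)) (x∉xs , xs⊆p)

distinct-neighbours≤degree : ∀ (G : SimpleGraph n) {i xs} →
  Unique xs → All (Adj G i) xs → length xs ≤ degree G i
distinct-neighbours≤degree G {i} xs! xs⊆N =
  subst (_ ≤_) (sym (degree≡∣neighbours∣ G i))
        (unique⊆⇒length≤∣p∣ xs! (All.map (∈-neighbours {G = G}) xs⊆N))

Adj? : (G : SimpleGraph n) (i j : Fin n) → Dec (Adj G i j)
Adj? G i j = adj G i j Bool.≟ true

Adj-sym : ∀ (G : SimpleGraph n) {i j} → Adj G i j → Adj G j i
Adj-sym G {i} {j} ij = trans (SimpleGraph.sym G j i) ij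

Adj-irrefl : ∀ (G : SimpleGraph n) {i} → ¬ Adj G i i
Adj-irrefl G {i} ii with trans (sym ii) (SimpleGraph.irref G i)
... | ()

infix 4 _⊆ᴳ_

_⊆ᴳ_ : SimpleGraph n → SimpleGraph n → Set
H ⊆ᴳ G = ∀ {i j} → Adj H i j → Adj G i j

Edge : Fin n → Fin n → Fin n → Fin n → Set
Edge a b i j = (i ≡ a × j ≡ b) ⊎ (i ≡ b × j ≡ a)

edge? : (a b i j : Fin n) → Dec (Edge a b i j)
edge? a b i j = (i ≟ a ×-dec j ≟ b) ⊎-dec (i ≟ b ×-dec j ≟ a)

Edge-sym : ∀ {a b i j : Fin n} → Edge a b i j → Edge a b j i
Edge-sym (inj₁ (refl , refl)) = inj₂ (refl , refl)
Edge-sym (inj₂ (refl , refl)) = inj₁ (refl , refl)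

Edge-irrefl : ∀ {a b i : Fin n} → a ≢ b → ¬ Edge a b i i
Edge-irrefl a≢b (inj₁ (refl , refl)) = a≢b refl
Edge-irrefl a≢b (inj₂ (refl , refl)) = a≢b refl

Edge-functional : ∀ {a b i j k : Fin n} → a ≢ b → Edge a b i j → Edge a b i k → j ≡ k
Edge-functional a≢b (inj₁ (refl , refl)) (inj₁ (_ , refl)) = refl
Edge-functional a≢b (inj₁ (refl , refl)) (inj₂ (i≡b , _))  = contradiction i≡b a≢b
Edge-functional a≢b (inj₂ (refl , refl)) (inj₁ (i≡a , _))  = contradiction (sym i≡a) a≢b
Edge-functional a≢b (inj₂ (refl , refl)) (inj₂ (_ , refl)) = refl

addEdge : (H : SimpleGraph n) (a b : Fin n) → a ≢ b → SimpleGraph n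
addEdge H a b a≢b = record
  { adj   = λ i j → adj H i j ∨ does (edge? a b i j)
  ; sym   = λ i j → cong₂ _∨_ (SimpleGraph.sym H i j)
                      (does-⇔ (mk⇔ Edge-sym Edge-sym) (edge? a b i j) (edge? a b j i))
  ; irref = λ i → cong₂ _∨_ (SimpleGraph.irref H i) (dec-false (edge? a b i i) (Edge-irrefl a≢b))
  }

module _ (H : SimpleGraph n) {a b : Fin n} (a≢b : a ≢ b) where

  H⊆addEdge : H ⊆ᴳ addEdge H a b a≢b
  H⊆addEdge ij = cong (_∨ _) ij

  Edge⇒Adj-addEdge : ∀ {i j} → Edge a b i j → Adj (addEdge H a b a≢b) i j
  Edge⇒Adj-addEdge {i} {j} e =
    trans (cong (adj H i j ∨_) (dec-true (edge? a b i j) e)) (∨-zeroʳ _)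

  Adj-addEdge⁻ : ∀ {i j} → Adj (addEdge H a b a≢b) i j → Adj H i j ⊎ Edge a b i j
  Adj-addEdge⁻ {i} {j} = by-cases (edge? a b i j)
    where
    by-cases : (e? : Dec (Edge a b i j)) → adj H i j ∨ does e? ≡ true → Adj H i j ⊎ Edge a b i j
    by-cases (yes e) _  = inj₂ e
    by-cases (no _)  ij = inj₁ (trans (sym (∨-identityʳ _)) ij)

  addEdge⊆ᴳ : ∀ {G} → H ⊆ᴳ G → Adj G a b → addEdge H a b a≢b ⊆ᴳ G
  addEdge⊆ᴳ {G} H⊆G ab ij with Adj-addEdge⁻ ij
  ... | inj₁ ij′                  = H⊆G ij′
  ... | inj₂ (inj₁ (refl , refl)) = ab
  ... | inj₂ (inj₂ (refl , refl)) = Adj-sym G ab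

module _ (Inv : SimpleGraph n → Set) {P : Fin n → Fin n → Set} (P? : ∀ a b → Dec (P a b))
  (step : ∀ {H a b} → Inv H → P a b → ¬ Adj H a b → ∃ λ H′ → Inv H′ × H ⊆ᴳ H′ × Adj H′ a b)
  where

  private
    cover : ∀ a b {H} → Inv H → ∃ λ H′ → Inv H′ × H ⊆ᴳ H′ × (P a b → Adj H′ a b)
    cover a b {H} I with Adj? H a b | P? a b
    ... | yes ab | _     = H , I , (λ ij → ij) , (λ _ → ab)
    ... | no _   | no ¬p = H , I , (λ ij → ij) , (λ p → contradiction p ¬p)
    ... | no ¬ab | yes p with step I p ¬ab
    ...   | H′ , I′ , H⊆H′ , ab = H′ , I′ , H⊆H′ , (λ _ → ab)

    cover-all : ∀ ps {H} → Inv H →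
      ∃ λ H′ → Inv H′ × H ⊆ᴳ H′ × All (λ ((a , b) : Fin n × Fin n) → P a b → Adj H′ a b) ps
    cover-all []             I = _ , I , (λ ij → ij) , []
    cover-all ((a , b) ∷ ps) I with cover a b I
    ... | H₁ , I₁ , H⊆H₁ , ab with cover-all ps I₁
    ...   | H′ , I′ , H₁⊆H′ , rest =
      H′ , I′ , (λ ij → H₁⊆H′ (H⊆H₁ ij)) , (λ p → H₁⊆H′ (ab p)) ∷ rest

  saturate : ∀ {H} → Inv H → ∃ λ H′ → Inv H′ × H ⊆ᴳ H′ × (∀ {a b} → P a b → Adj H′ a b)
  saturate I with cover-all (cartesianProduct (allFin n) (allFin n)) I
  ... | H′ , I′ , H⊆H′ , covered =
    H′ , I′ , H⊆H′ , λ {a} {b} → All.lookup covered (∈-cartesianProduct⁺ (∈-allFin a) (∈-allFin b))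

avoid₂ : (x y : Fin 3) → ∃ λ z → z ≢ x × z ≢ y
avoid₂ 0F 0F = 1F , (λ ()) , (λ ())
avoid₂ 0F 1F = 2F , (λ ()) , (λ ())
avoid₂ 0F 2F = 1F , (λ ()) , (λ ())
avoid₂ 1F 0F = 2F , (λ ()) , (λ ())
avoid₂ 1F 1F = 0F , (λ ()) , (λ ())
avoid₂ 1F 2F = 0F , (λ ()) , (λ ())
avoid₂ 2F 0F = 1F , (λ ()) , (λ ())
avoid₂ 2F 1F = 0F , (λ ()) , (λ ())
avoid₂ 2F 2F = 0F , (λ ()) , (λ ())

module _ {m} {i j : Fin m} where

  transpose-injective : ∀ {x y} → transpose i j x ≡ transpose i j y → x ≡ y
  transpose-injective eq =
    trans (sym (transpose-inverse j i)) (trans (cong (transpose j i) eq) (transpose-inverse j i))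

  transpose-fixes : ∀ {k} → k ≢ i → k ≢ j → transpose i j k ≡ k
  transpose-fixes {k} k≢i k≢j rewrite dec-false (k ≟ i) k≢i | dec-false (k ≟ j) k≢j = refl

  transpose-i↦j : transpose i j i ≡ j
  transpose-i↦j rewrite dec-true (i ≟ i) refl = refl

restrict : ∀ {G H : SimpleGraph n} → G ⊆ᴳ H → Proper3EdgeColoring H → Proper3EdgeColoring G
restrict G⊆H C = record
  { col     = col
  ; col-sym = λ i j ij → col-sym i j (G⊆H ij)
  ; proper  = λ i j k ij ik → proper i j k (G⊆H ij) (G⊆H ik)
  }
  where open Proper3EdgeColoring C

module _ {H : SimpleGraph n} (C : Proper3EdgeColoring H) where

  open Proper3EdgeColoring C

  Uses : Fin n → Fin 3 → Set
  Uses w x = ∃ λ j → Adj H w j × col w j ≡ x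

  Uses? : ∀ w x → Dec (Uses w x)
  Uses? w x = any? λ j → Adj? H w j ×-dec col w j ≟ x

  extend : ∀ {a b} (a≢b : a ≢ b) x → ¬ Uses a x → ¬ Uses b x →
    Proper3EdgeColoring (addEdge H a b a≢b)
  extend {a} {b} a≢b x a-free b-free = record
    { col = col′ ; col-sym = col′-sym ; proper = col′-proper }
    where
    col′ : Fin n → Fin n → Fin 3
    col′ i j = if does (edge? a b i j) then x else col i j

    col′-edge : ∀ {i j} → Edge a b i j → col′ i j ≡ x
    col′-edge {i} {j} e rewrite dec-true (edge? a b i j) e = refl

    col′-old : ∀ {i j} → ¬ Edge a b i j → col′ i j ≡ col i j
    col′-old {i} {j} ¬e rewrite dec-false (edge? a b i j) ¬e = refl

    old : ∀ {i j} → Adj (addEdge H a b a≢b) i j → ¬ Edge a b i j → Adj H i j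
    old ij ¬e with Adj-addEdge⁻ H a≢b ij
    ... | inj₁ ij′ = ij′
    ... | inj₂ e   = contradiction e ¬e

    free : ∀ {i j k} → Edge a b i j → Adj H i k → col i k ≢ x
    free (inj₁ (refl , _)) ik eq = a-free (_ , ik , eq)
    free (inj₂ (refl , _)) ik eq = b-free (_ , ik , eq)

    col′-sym : ∀ i j → Adj (addEdge H a b a≢b) i j → col′ i j ≡ col′ j i
    col′-sym i j ij = by-cases (edge? a b i j)
      where
      by-cases : Dec (Edge a b i j) → col′ i j ≡ col′ j i
      by-cases (yes e) = trans (col′-edge e) (sym (col′-edge (Edge-sym e)))
      by-cases (no ¬e) =
        trans (col′-old ¬e) (trans (col-sym i j (old ij ¬e)) (sym (col′-old (¬e ∘ Edge-sym))))

    col′-proper : ∀ i j k → Adj (addEdge H a b a≢b) i j → Adj (addEdge H a b a≢b) i k →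
      j ≢ k → col′ i j ≢ col′ i k
    col′-proper i j k ij ik j≢k = by-cases (edge? a b i j) (edge? a b i k)
      where
      by-cases : Dec (Edge a b i j) → Dec (Edge a b i k) → col′ i j ≢ col′ i k
      by-cases (yes e) (yes e′) _  = j≢k (Edge-functional a≢b e e′)
      by-cases (yes e) (no ¬e′) eq =
        free e (old ik ¬e′) (trans (sym (col′-old ¬e′)) (trans (sym eq) (col′-edge e)))
      by-cases (no ¬e) (yes e′) eq =
        free e′ (old ij ¬e) (trans (sym (col′-old ¬e)) (trans eq (col′-edge e′)))
      by-cases (no ¬e) (no ¬e′) eq =
        proper i j k (old ij ¬e) (old ik ¬e′) j≢k
          (trans (sym (col′-old ¬e)) (trans eq (col′-old ¬e′)))

  module _ {G : SimpleGraph n} (H⊆G : H ⊆ᴳ G) {w o : Fin n} (wo : Adj G w o) (¬wo : ¬ Adj H w o)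
    where

    private
      ≢uncoloured : ∀ {j} → Adj H w j → j ≢ o
      ≢uncoloured wj refl = ¬wo wj

      colours-differ : ∀ {j k x y} → col w j ≡ x → col w k ≡ y → x ≢ y → j ≢ k
      colours-differ refl refl x≢y refl = x≢y refl

    uses-one-colour : degree G w ≤ 2 → ∃ λ c → ∀ {x} → Uses w x → x ≡ c
    uses-one-colour deg≤2 with any? (λ x → Uses? w x)
    ... | no none = 0F , λ w-x → contradiction (_ , w-x) none
    ... | yes (c , j , wj , e) = c , only-c
      where
      only-c : ∀ {x} → Uses w x → x ≡ c
      only-c {x} (k , wk , e′) with x ≟ c
      ... | yes x≡c = x≡c
      ... | no x≢c  = contradiction deg≤2 (<⇒≱ (distinct-neighbours≤degree G
              ((colours-differ e′ e x≢c ∷ ≢uncoloured wk ∷ []) ∷ (≢uncoloured wj ∷ []) ∷ [] ∷ [])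
              (H⊆G wk ∷ H⊆G wj ∷ wo ∷ [])))

    misses-colour : degree G w ≤ 3 → ∃ λ x → ¬ Uses w x
    misses-colour deg≤3 with all? (λ x → Uses? w x)
    ... | no ¬all = ¬∀⟶∃¬ 3 _ (λ x → Uses? w x) ¬all
    ... | yes all with all 0F | all 1F | all 2F
    ...   | j₀ , wj₀ , e₀ | j₁ , wj₁ , e₁ | j₂ , wj₂ , e₂ =
      contradiction deg≤3 (<⇒≱ (distinct-neighbours≤degree G
        ( (colours-differ e₀ e₁ (λ ()) ∷ colours-differ e₀ e₂ (λ ()) ∷ ≢uncoloured wj₀ ∷ [])
        ∷ (colours-differ e₁ e₂ (λ ()) ∷ ≢uncoloured wj₁ ∷ [])
        ∷ (≢uncoloured wj₂ ∷ [])
        ∷ [] ∷ [])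
        (H⊆G wj₀ ∷ H⊆G wj₁ ∷ H⊆G wj₂ ∷ wo ∷ [])))

  module _ (α β : Fin 3) (K : Subset n)
    (K-closed : ∀ {w z} → w ∈ K → Adj H w z → col w z ≡ α ⊎ col w z ≡ β → z ∈ K) where

    swapped-col : Fin n → Fin n → Fin 3
    swapped-col i j = if does (i ∈? K) then transpose α β (col i j) else col i j

    swapped-col-inside : ∀ {i j} → i ∈ K → swapped-col i j ≡ transpose α β (col i j)
    swapped-col-inside {i} i∈K rewrite dec-true (i ∈? K) i∈K = refl

    swapped-col-outside : ∀ {i j} → i ∉ K → swapped-col i j ≡ col i j
    swapped-col-outside {i} i∉K rewrite dec-false (i ∈? K) i∉K = refl

    private
      boundary-fixed : ∀ {i j} → i ∈ K → j ∉ K → Adj H i j → transpose α β (col i j) ≡ col i j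
      boundary-fixed i∈K j∉K ij = transpose-fixes (λ c≡α → j∉K (K-closed i∈K ij (inj₁ c≡α)))
                                                  (λ c≡β → j∉K (K-closed i∈K ij (inj₂ c≡β)))

    swap-colours : Proper3EdgeColoring H
    swap-colours = record { col = swapped-col ; col-sym = swapped-sym ; proper = swapped-proper }
      where
      swapped-sym : ∀ i j → Adj H i j → swapped-col i j ≡ swapped-col j i
      swapped-sym i j ij with i ∈? K | j ∈? K
      ... | yes _   | yes _   = cong (transpose α β) (col-sym i j ij)
      ... | yes i∈K | no j∉K  = trans (boundary-fixed i∈K j∉K ij) (col-sym i j ij)
      ... | no i∉K  | yes j∈K = trans (col-sym i j ij) (sym (boundary-fixed j∈K i∉K (Adj-sym H ij)))
      ... | no _    | no _    = col-sym i j ij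

      swapped-proper : ∀ i j k → Adj H i j → Adj H i k → j ≢ k → swapped-col i j ≢ swapped-col i k
      swapped-proper i j k ij ik j≢k with i ∈? K
      ... | yes _ = proper i j k ij ik j≢k ∘ transpose-injective
      ... | no _  = proper i j k ij ik j≢k

module _ {S : Fin n → Fin n → Set} (S? : ∀ w z → Dec (S w z)) (v : Fin n) where

  HasPredecessors : Subset n → Set
  HasPredecessors K = ∀ {z} → z ∈ K → z ≢ v → ∃ λ w → w ∈ K × S w z

  record RootedClosure : Set where
    field
      members     : Subset n
      root∈       : v ∈ members
      predecessor : HasPredecessors members
      closed      : ∀ {w z} → w ∈ members → S w z → z ∈ members

  private
    grow : ∀ K → Acc _⊃_ K → v ∈ K → HasPredecessors K → RootedClosure
    grow K (acc larger) v∈K K-preds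
      with any? (λ w → any? (λ z → w ∈? K ×-dec S? w z ×-dec ¬? (z ∈? K)))
    ... | no no-exit =
      record { members = K ; root∈ = v∈K ; predecessor = K-preds ; closed = closed }
      where
      closed : ∀ {w z} → w ∈ K → S w z → z ∈ K
      closed {w} {z} w∈K wz with z ∈? K
      ... | yes z∈K = z∈K
      ... | no z∉K  = contradiction (w , z , w∈K , wz , z∉K) no-exit
    ... | yes (w , z , w∈K , wz , z∉K) = grow (K ∪ ⁅ z ⁆) (larger K⊂K∪z) (⊆K∪z v∈K) preds
      where
      ⊆K∪z : ∀ {y} → y ∈ K → y ∈ K ∪ ⁅ z ⁆
      ⊆K∪z = p⊆p∪q ⁅ z ⁆

      K⊂K∪z : K ⊂ K ∪ ⁅ z ⁆
      K⊂K∪z = ⊆K∪z , z , x∈p∪q⁺ (inj₂ (x∈⁅x⁆ z)) , z∉K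

      preds : HasPredecessors (K ∪ ⁅ z ⁆)
      preds {y} y∈ y≢v with x∈p∪q⁻ K ⁅ z ⁆ y∈
      ... | inj₁ y∈K with K-preds y∈K y≢v
      ...   | x , x∈K , xy = x , ⊆K∪z x∈K , xy
      preds y∈ y≢v | inj₂ y∈⁅z⁆ rewrite x∈⁅y⁆⇒x≡y z y∈⁅z⁆ = w , ⊆K∪z w∈K , wz

  rooted-closure : RootedClosure
  rooted-closure = grow ⁅ v ⁆ (⊃-wellFounded ⁅ v ⁆)
    (x∈⁅x⁆ v) (λ z∈⁅v⁆ z≢v → contradiction (x∈⁅y⁆⇒x≡y v z∈⁅v⁆) z≢v)

module _ (inU : Fin n → Bool) where

  different-sides : ∀ {u v} → inU u ≡ true → inU v ≡ false → u ≢ v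
  different-sides u∈U v∈V refl = contradiction (trans (sym u∈U) v∈V) λ ()

  NoUEdge : SimpleGraph n → Set
  NoUEdge H = ∀ {i j} → Adj H i j → inU i ≡ true → inU j ≡ true → ⊥

-- The chain is grown in one direction: out of a U-vertex along its c-edge, out of a V-vertex
-- along its β-edge. Then every vertex other than v is entered along the other colour, and
-- since a vertex has at most one edge of each colour, the chain is closed under β- and
-- c-edges in both directions.
module KempeChain {H : SimpleGraph n} (inU : Fin n → Bool) (no-U-edge : NoUEdge inU H)
  (C : Proper3EdgeColoring H) {β c : Fin 3} (β≢c : β ≢ c)
  (β-off-V : ∀ {i j} → Adj H i j → inU i ≡ false → inU j ≡ false →
               Proper3EdgeColoring.col C i j ≢ β)
  {v : Fin n} (v∈V : inU v ≡ false) (v-misses-c : ¬ Uses C v c) where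

  open Proper3EdgeColoring C

  leave enter : Fin n → Fin 3
  leave w = if inU w then c else β
  enter w = if inU w then β else c

  ChainStep : Fin n → Fin n → Set
  ChainStep w z = Adj H w z × col w z ≡ leave w

  chainStep? : ∀ w z → Dec (ChainStep w z)
  chainStep? w z = Adj? H w z ×-dec col w z ≟ leave w

  open RootedClosure (rooted-closure chainStep? v) renaming (members to K)

  private
    leave≡enter : ∀ {w z} → Adj H w z → col w z ≡ leave w → leave w ≡ enter z
    leave≡enter {w} {z} wz e with inU w in w-side | inU z in z-side
    ... | true  | true  = ⊥-elim (no-U-edge wz w-side z-side)
    ... | true  | false = refl
    ... | false | true  = refl
    ... | false | false = ⊥-elim (β-off-V wz w-side z-side e)

    leave-or-enter : ∀ {w z} → col w z ≡ c ⊎ col w z ≡ β → col w z ≡ leave w ⊎ col w z ≡ enter w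
    leave-or-enter {w} e with inU w
    ... | true  = e
    ... | false = Sum.swap e

    root-not-entered : ∀ {z} → Adj H v z → col v z ≢ enter v
    root-not-entered vz e rewrite v∈V = v-misses-c (_ , vz , e)

  entered : ∀ {z} → z ∈ K → z ≢ v → ∃ λ w → w ∈ K × Adj H z w × col z w ≡ enter z
  entered z∈K z≢v with predecessor z∈K z≢v
  ... | w , w∈K , wz , e =
    w , w∈K , Adj-sym H wz , trans (col-sym _ _ (Adj-sym H wz)) (trans e (leave≡enter wz e))

  closed-under-c-β : ∀ {w z} → w ∈ K → Adj H w z → col w z ≡ c ⊎ col w z ≡ β → z ∈ K
  closed-under-c-β {w} {z} w∈K wz e with leave-or-enter e
  ... | inj₁ e-leave = closed w∈K (wz , e-leave)
  ... | inj₂ e-enter with entered w∈K (λ { refl → root-not-entered wz e-enter })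
  ...   | w′ , w′∈K , ww′ , e′ with z ≟ w′
  ...     | yes refl = w′∈K
  ...     | no z≢w′  = contradiction (trans e-enter (sym e′)) (proper w z w′ wz ww′ z≢w′)

  recoloured : Proper3EdgeColoring H
  recoloured = swap-colours C c β K closed-under-c-β

  v-misses-β : ¬ Uses recoloured v β
  v-misses-β (j , vj , e) = v-misses-c (j , vj , transpose-injective swapped-to-β)
    where
    swapped-to-β : transpose c β (col v j) ≡ transpose c β c
    swapped-to-β =
      trans (sym (swapped-col-inside C c β K closed-under-c-β root∈))
            (trans e (sym (transpose-i↦j {i = c})))

  module _ {u : Fin n} (u∈U : inU u ≡ true) (u-uses-c : ∀ {x} → Uses C u x → x ≡ c) where

    u∉K : u ∉ K
    u∉K u∈K with entered u∈K (different-sides inU u∈U v∈V)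
    ... | w , _ , uw , e rewrite u∈U = β≢c (u-uses-c (w , uw , e))

    u-misses-β : ¬ Uses recoloured u β
    u-misses-β (j , uj , e) =
      β≢c (u-uses-c (j , uj , trans (sym (swapped-col-outside C c β K closed-under-c-β u∉K)) e))

module Partitioned {n} (G : SimpleGraph n) (subcubic : Subcubic G) (inU : Fin n → Bool)
  (V-edge-unique : ∀ a b c d → inU a ≡ false → inU b ≡ false → inU c ≡ false → inU d ≡ false →
      Adj G a b → Adj G c d → ((a ≡ c) × (b ≡ d)) ⊎ ((a ≡ d) × (b ≡ c)))
  (U-degree≤2 : ∀ u → inU u ≡ true → degree G u ≤ 2) where

  G[V] : SimpleGraph n
  G[V] = record
    { adj   = λ i j → adj G i j ∧ (not (inU i) ∧ not (inU j))
    ; sym   = λ i j → cong₂ _∧_ (SimpleGraph.sym G i j) (∧-comm (not (inU i)) (not (inU j)))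
    ; irref = λ i → cong (_∧ _) (SimpleGraph.irref G i)
    }

  Adj-G[V]⁻ : ∀ {i j} → Adj G[V] i j → Adj G i j × inU i ≡ false × inU j ≡ false
  Adj-G[V]⁻ {i} {j} ij with adj G i j | inU i | inU j
  ... | true  | false | false = refl , refl , refl
  ... | true  | false | true  = contradiction ij λ ()
  ... | true  | true  | _     = contradiction ij λ ()
  ... | false | _     | _     = contradiction ij λ ()

  Adj-G[V]⁺ : ∀ {i j} → Adj G i j → inU i ≡ false → inU j ≡ false → Adj G[V] i j
  Adj-G[V]⁺ ij i∈V j∈V rewrite ij | i∈V | j∈V = refl

  colour-G[V] : Proper3EdgeColoring G[V]
  colour-G[V] = record { col = λ _ _ → 0F ; col-sym = λ _ _ _ → refl ; proper = single-edge }
    where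
    single-edge : ∀ i j k → Adj G[V] i j → Adj G[V] i k → j ≢ k → 0F ≢ 0F
    single-edge i j k ij ik j≢k _ with Adj-G[V]⁻ ij | Adj-G[V]⁻ ik
    ... | ij′ , i∈V , j∈V | ik′ , _ , k∈V with V-edge-unique i j i k i∈V j∈V i∈V k∈V ij′ ik′
    ...   | inj₁ (_ , j≡k)  = j≢k j≡k
    ...   | inj₂ (refl , _) = Adj-irrefl G ik′

  module _ {H : SimpleGraph n} (H⊆G : H ⊆ᴳ G) (C : Proper3EdgeColoring H) where

    open Proper3EdgeColoring C

    colour-unused-on-V : ∀ c → ∃ λ β → β ≢ c ×
      (∀ {i j} → Adj H i j → inU i ≡ false → inU j ≡ false → col i j ≢ β)
    colour-unused-on-V c
      with any? (λ a → any? (λ b → Adj? H a b ×-dec inU a Bool.≟ false ×-dec inU b Bool.≟ false))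
    ... | no no-V-edge with avoid₂ c c
    ...   | β , β≢c , _ = β , β≢c , λ {i} {j} ij i∈V j∈V _ → no-V-edge (i , j , ij , i∈V , j∈V)
    colour-unused-on-V c | yes (a , b , ab , a∈V , b∈V) with avoid₂ c (col a b)
    ...   | β , β≢c , β≢col-ab =
      β , β≢c , λ ij i∈V j∈V e → β≢col-ab (trans (sym e) (same-edge ij i∈V j∈V))
      where
      same-edge : ∀ {i j} → Adj H i j → inU i ≡ false → inU j ≡ false → col i j ≡ col a b
      same-edge {i} {j} ij i∈V j∈V with V-edge-unique i j a b i∈V j∈V a∈V b∈V (H⊆G ij) (H⊆G ab)
      ... | inj₁ (refl , refl) = refl
      ... | inj₂ (refl , refl) = col-sym i j ij

    colour-UV-edge : ∀ {u v} (u≢v : u ≢ v) → NoUEdge inU H → Adj G u v → ¬ Adj H u v →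
      inU u ≡ true → inU v ≡ false → Proper3EdgeColoring (addEdge H u v u≢v)
    colour-UV-edge {u} {v} u≢v no-U-edge uv ¬uv u∈U v∈V
      with uses-one-colour C {G = G} H⊆G {u} uv ¬uv (U-degree≤2 u u∈U)
    ... | c , u-uses-c with Uses? C v c
    ...   | yes v-uses-c
            with misses-colour C {G = G} H⊆G {v} (Adj-sym G uv) (¬uv ∘ Adj-sym H) (subcubic v)
    ...     | x , v-misses-x = extend C u≢v x (λ u-x → x≢c (u-uses-c u-x)) v-misses-x
      where
      x≢c : x ≢ c
      x≢c refl = v-misses-x v-uses-c
    colour-UV-edge {u} {v} u≢v no-U-edge uv ¬uv u∈U v∈V | c , u-uses-c | no v-misses-c
      with colour-unused-on-V c
    ... | β , β≢c , β-off-V = extend recoloured u≢v β (u-misses-β u∈U u-uses-c) v-misses-β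
      where open KempeChain inU no-U-edge C β≢c β-off-V v∈V v-misses-c

    colour-UU-edge : ∀ {a b} (a≢b : a ≢ b) → Adj G a b → ¬ Adj H a b →
      inU a ≡ true → inU b ≡ true → Proper3EdgeColoring (addEdge H a b a≢b)
    colour-UU-edge {a} {b} a≢b ab ¬ab a∈U b∈U
      with uses-one-colour C {G = G} H⊆G {a} ab ¬ab (U-degree≤2 a a∈U)
         | uses-one-colour C {G = G} H⊆G {b} (Adj-sym G ab) (¬ab ∘ Adj-sym H) (U-degree≤2 b b∈U)
    ... | cᵃ , a-uses-cᵃ | cᵇ , b-uses-cᵇ with avoid₂ cᵃ cᵇ
    ...   | x , x≢cᵃ , x≢cᵇ = extend C a≢b x (x≢cᵃ ∘ a-uses-cᵃ) (x≢cᵇ ∘ b-uses-cᵇ)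

  ColouredSubgraph : SimpleGraph n → Set
  ColouredSubgraph H = H ⊆ᴳ G × Proper3EdgeColoring H

  ColouredWithoutUEdge : SimpleGraph n → Set
  ColouredWithoutUEdge H = NoUEdge inU H × ColouredSubgraph H

  UV-Edge UU-Edge : Fin n → Fin n → Set
  UV-Edge a b = Adj G a b × inU a ≡ true × inU b ≡ false
  UU-Edge a b = Adj G a b × inU a ≡ true × inU b ≡ true

  UV-Edge? : ∀ a b → Dec (UV-Edge a b)
  UV-Edge? a b = Adj? G a b ×-dec inU a Bool.≟ true ×-dec inU b Bool.≟ false

  UU-Edge? : ∀ a b → Dec (UU-Edge a b)
  UU-Edge? a b = Adj? G a b ×-dec inU a Bool.≟ true ×-dec inU b Bool.≟ true

  G[V]-coloured : ColouredWithoutUEdge G[V]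
  G[V]-coloured = no-U-edge , proj₁ ∘ Adj-G[V]⁻ , colour-G[V]
    where
    no-U-edge : NoUEdge inU G[V]
    no-U-edge {i} {j} ij i∈U _ = different-sides inU i∈U (proj₁ (proj₂ (Adj-G[V]⁻ ij))) refl

  add-UV-edge : ∀ {H a b} → ColouredWithoutUEdge H → UV-Edge a b → ¬ Adj H a b →
    ∃ λ H′ → ColouredWithoutUEdge H′ × H ⊆ᴳ H′ × Adj H′ a b
  add-UV-edge {H} {u} {v} (no-U-edge , H⊆G , C) (uv , u∈U , v∈V) ¬uv =
    addEdge H u v u≢v ,
    (no-U-edge′ , addEdge⊆ᴳ H u≢v {G} H⊆G uv , colour-UV-edge H⊆G C u≢v no-U-edge uv ¬uv u∈U v∈V) ,
    H⊆addEdge H u≢v , Edge⇒Adj-addEdge H u≢v (inj₁ (refl , refl))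
    where
    u≢v : u ≢ v
    u≢v = different-sides inU u∈U v∈V

    no-U-edge′ : NoUEdge inU (addEdge H u v u≢v)
    no-U-edge′ ij i∈U j∈U with Adj-addEdge⁻ H u≢v ij
    ... | inj₁ ij′                  = no-U-edge ij′ i∈U j∈U
    ... | inj₂ (inj₁ (refl , refl)) = different-sides inU j∈U v∈V refl
    ... | inj₂ (inj₂ (refl , refl)) = different-sides inU i∈U v∈V refl

  add-UU-edge : ∀ {H a b} → ColouredSubgraph H → UU-Edge a b → ¬ Adj H a b →
    ∃ λ H′ → ColouredSubgraph H′ × H ⊆ᴳ H′ × Adj H′ a b
  add-UU-edge {H} {a} {b} (H⊆G , C) (ab , a∈U , b∈U) ¬ab =
    addEdge H a b a≢b ,
    (addEdge⊆ᴳ H a≢b {G} H⊆G ab , colour-UU-edge H⊆G C a≢b ab ¬ab a∈U b∈U) ,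
    H⊆addEdge H a≢b , Edge⇒Adj-addEdge H a≢b (inj₁ (refl , refl))
    where
    a≢b : a ≢ b
    a≢b refl = Adj-irrefl G ab

lemma2 : ∀ {n} (G : SimpleGraph n) → Subcubic G →
    (inU : Fin n → Bool) →
    (∀ a b c d → inU a ≡ false → inU b ≡ false → inU c ≡ false → inU d ≡ false →
      Adj G a b → Adj G c d → ((a ≡ c) × (b ≡ d)) ⊎ ((a ≡ d) × (b ≡ c))) →
    (∀ u → inU u ≡ true → degree G u ≤ 2) →
    Proper3EdgeColoring G
lemma2 G subcubic inU V-edge-unique U-degree≤2 = colouring
  where
  open Partitioned G subcubic inU V-edge-unique U-degree≤2

  colouring : Proper3EdgeColoring G
  colouring with saturate ColouredWithoutUEdge UV-Edge? add-UV-edge G[V]-coloured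
  ... | H₁ , (_ , H₁-coloured) , G[V]⊆H₁ , UV⊆H₁
        with saturate ColouredSubgraph UU-Edge? add-UU-edge H₁-coloured
  ...   | H₂ , (_ , C₂) , H₁⊆H₂ , UU⊆H₂ = restrict G⊆H₂ C₂
    where
    G⊆H₂ : G ⊆ᴳ H₂
    G⊆H₂ {i} {j} ij with inU i in i-side | inU j in j-side
    ... | true  | true  = UU⊆H₂ (ij , i-side , j-side)
    ... | true  | false = H₁⊆H₂ (UV⊆H₁ (ij , i-side , j-side))
    ... | false | true  = H₁⊆H₂ (Adj-sym H₁ (UV⊆H₁ (Adj-sym G ij , j-side , i-side)))
    ... | false | false = H₁⊆H₂ (G[V]⊆H₁ (Adj-G[V]⁺ ij i-side j-side))
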